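{- Let $\lambda\in\mathbb{R}$, let $r$ be a nonnegative integer, and let $k\geq 0$ be an integer. Then, as an identity of expansions in powers of $1/x$, $$\Big(\frac{1}{x}\Big)^{k+1}=\sum_{n=k}^{\infty}{n+r \brack k+r}_{r,\lambda}\frac{1}{(x+r)(x+r+\lambda)\cdots(x+r+n\lambda)}=\sum_{n=k}^{\infty}{n+r \brack k+r}_{r,\lambda}\frac{1}{n!\binom{x+r+(n-1)\lambda}{n}_{\lambda}(x+r+n\lambda)}.$$
   Context: For $\lambda\in\mathbb{R}$, $(x)_{0,\lambda}=1$, $(x)_{n,\lambda}=x(x-\lambda)\cdots(x-(n-1)\lambda)$, and $\langle x\rangle_{0,\lambda}=1$, $\langle x\rangle_{n,\lambda}=x(x+\lambda)\cdots(x+(n-1)\lambda)$ for $n\ge1$. The $\lambda$-binomial coefficient is $\binom{x}{n}_{\lambda}=\frac{(x)_{n,\lambda}}{n!}$. For a nonnegative integer $r$, the $\lambda$-analogues of unsigned $r$-Stirling numbers of the first kind ${n+r \brack k+r}_{r,\lambda}$ are defined by $\langle x+r\rangle_{n,\lambda}=\sum_{k=0}^n{n+r \brack k+r}_{r,\lambda}x^k$ for $n\ge 0$. -}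

module Defs where

open import Level using (Level)
open import Algebra.Bundles using (CommutativeRing)
open import Data.Nat as ℕ using (ℕ; zero; suc; _∸_; _≡ᵇ_)
open import Data.Bool using (if_then_else_)
open import Data.List using (List; []; _∷_; map; foldr; upTo)

-- Everything is done over an arbitrary commutative ring R (λ ∈ R).
-- x is a formal variable; t stands for 1/x.  A "series" is a formal
-- power series in t = 1/x, given by its coefficient function.
module Series {c ℓ : Level} (R : CommutativeRing c ℓ) where
  open CommutativeRing R

  natR : ℕ → Carrier
  natR zero    = 0#
  natR (suc n) = 1# + natR n

  powR : Carrier → ℕ → Carrier
  powR a zero    = 1#
  powR a (suc m) = a * powR a m

  -- Polynomials in x: coefficient lists, lowest degree first.
  Poly : Set c
  Poly = List Carrier

  addP : Poly → Poly → Poly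
  addP []      q       = q
  addP (a ∷ p) []      = a ∷ p
  addP (a ∷ p) (b ∷ q) = (a + b) ∷ addP p q

  mulXplus : Carrier → Poly → Poly
  mulXplus a p = addP (0# ∷ p) (map (a *_) p)

  coeffP : Poly → ℕ → Carrier
  coeffP []      _       = 0#
  coeffP (a ∷ p) zero    = a
  coeffP (a ∷ p) (suc k) = coeffP p k

  -- ⟨x + r⟩_{n,λ} = (x+r)(x+r+λ)⋯(x+r+(n-1)λ) as a polynomial in x
  risingPoly : Carrier → ℕ → ℕ → Poly
  risingPoly lam r zero    = 1# ∷ []
  risingPoly lam r (suc n) = mulXplus (natR r + natR n * lam) (risingPoly lam r n)

  -- [n+r, k+r]_{r,λ} : coefficient of x^k in ⟨x + r⟩_{n,λ}
  stirR : Carrier → ℕ → ℕ → ℕ → Carrier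
  stirR lam r n k = coeffP (risingPoly lam r n) k

  Ser : Set c
  Ser = ℕ → Carrier

  sumBelow : (ℕ → Carrier) → ℕ → Carrier
  sumBelow f zero    = 0#
  sumBelow f (suc m) = sumBelow f m + f m

  sumFromTo : ℕ → ℕ → (ℕ → Carrier) → Carrier
  sumFromTo k N f = sumBelow (λ j → f (k ℕ.+ j)) (suc N ∸ k)

  oneS : Ser
  oneS zero    = 1#
  oneS (suc _) = 0#

  mulS : Ser → Ser → Ser
  mulS f g N = sumBelow (λ i → f i * g (N ∸ i)) (suc N)

  scaleS : Carrier → Ser → Ser
  scaleS a f N = a * f N

  tpow : ℕ → Ser
  tpow m N = if N ≡ᵇ m then 1# else 0#

  -- expansion of 1/(x + a) in powers of 1/x :  Σ_{m≥0} (-a)^m t^{m+1}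
  recipLin : Carrier → Ser
  recipLin a zero    = 0#
  recipLin a (suc m) = powR (- a) m

  recipProd : List Carrier → Ser
  recipProd = foldr (λ a s → mulS (recipLin a) s) oneS

  -- Σ_{n ≥ k} F n, for a family with F n = O(t^{n+1}): the coefficient
  -- of t^N only receives contributions from n ≤ N.
  sumFromS : ℕ → (ℕ → Ser) → Ser
  sumFromS k F N = sumFromTo k N (λ n → F n N)

  _≋_ : Ser → Ser → Set ℓ
  f ≋ g = ∀ N → f N ≈ g N

  -- (x+r)(x+r+λ)⋯(x+r+nλ) : constants r + jλ, j = 0..n
  factors₁ : Carrier → ℕ → ℕ → List Carrier
  factors₁ lam r n = map (λ j → natR r + natR j * lam) (upTo (suc n))

  -- n! binom(x+r+(n-1)λ, n)_λ (x+r+nλ) = (y)_{n,λ} (x+r+nλ), y = x+r+(n-1)λ,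
  -- (y)_{n,λ} = y(y-λ)⋯(y-(n-1)λ) : constants r + (n-1)λ - iλ, i = 0..n-1,
  -- followed by the constant r + nλ
  factors₂ : Carrier → ℕ → ℕ → List Carrier
  factors₂ lam r n =
    foldr _∷_ ((natR r + natR n * lam) ∷ [])
      (map (λ i → (natR r + (natR n * lam - lam)) - natR i * lam) (upTo n))

{-# OPTIONS --safe #-}
module Submission where

-- Take any constants a₀, a₁, … in place of r + jλ, let s(n,k) be the coefficient of x^k in
-- (x+a₀)⋯(x+a_{n-1}), and write t = 1/x. We show t^{k+1} = Σₙ s(n,k) / ((x+a₀)⋯(x+aₙ))
-- coefficientwise, by induction on the power of t, simultaneously for all sequences a.
-- Multiplying the sum by x + a₀ turns each denominator into the one for the shifted sequence
-- a ∘ suc, and expanding (x+a₀)⋯(x+aₙ) along its first factor gives s(n+1,k) = s′(n,k-1) + a₀ s′(n,k)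
-- with s′ the coefficients for a ∘ suc; by induction the product is t^k + a₀ t^{k+1} = (x + a₀) t^{k+1}. The second denominator has the
-- same linear factors as the first in another order, and multiplications by 1/(x+a) commute.

open import Defs
open import Level using (Level)
open import Algebra.Bundles using (CommutativeRing)
open import Data.Nat using (ℕ; suc)
open import Data.Product using (_×_)

open import Data.Nat as ℕ using (zero; _∸_; _≤_; _<_; z≤n; s≤s)
import Data.Nat.Properties as ℕ
open import Data.Product using (_,_)
open import Data.Sum using (inj₁; inj₂)
open import Data.List using ([]; _∷_; _++_; map; reverse; upTo; applyUpTo; applyDownFrom)
open import Data.List.Properties using (map-upTo; applyUpTo-∷ʳ; reverse-applyUpTo; ++-is-foldr)
open import Data.List.Relation.Binary.Pointwise as Pointwise using (Pointwise; []; _∷_)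
open import Data.Maybe using (nothing)
open import Function using (_∘_)
open import Relation.Binary.Bundles using (Setoid)
import Relation.Binary.PropositionalEquality as P
import Relation.Binary.Reasoning.Setoid as SetoidReasoning
open import Tactic.RingSolver.Core.AlmostCommutativeRing using (fromCommutativeRing)

module InverseFactorialSeries {c ℓ : Level} (R : CommutativeRing c ℓ) where
  open CommutativeRing R hiding (zero)
  open Series R
  open SetoidReasoning setoid
  open import Algebra.Properties.Group +-group using (//-rightDividesˡ) renaming (∙-cancelʳ to +-cancelʳ)
  open import Algebra.Properties.Ring ring using (-‿distribˡ-*)
  open import Tactic.RingSolver.NonReflective (fromCommutativeRing R (λ _ → nothing))
    using (solve; _⊕_; _⊗_; _⊜_)
  import Data.List.Relation.Binary.Permutation.Setoid setoid as ↭
  open ↭ using (_↭_)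

  sumBelow-cong : ∀ {f g : ℕ → Carrier} m → (∀ i → i < m → f i ≈ g i) → sumBelow f m ≈ sumBelow g m
  sumBelow-cong zero    f≈g = refl
  sumBelow-cong (suc m) f≈g =
    +-cong (sumBelow-cong m (λ i i<m → f≈g i (ℕ.m<n⇒m<1+n i<m))) (f≈g m ℕ.≤-refl)

  sumBelow-zero : ∀ {f : ℕ → Carrier} m → (∀ i → i < m → f i ≈ 0#) → sumBelow f m ≈ 0#
  sumBelow-zero zero    f≈0 = refl
  sumBelow-zero (suc m) f≈0 =
    trans (+-cong (sumBelow-zero m (λ i i<m → f≈0 i (ℕ.m<n⇒m<1+n i<m))) (f≈0 m ℕ.≤-refl)) (+-identityʳ 0#)

  sumBelow-+ : ∀ (f g : ℕ → Carrier) m → sumBelow (λ i → f i + g i) m ≈ sumBelow f m + sumBelow g m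
  sumBelow-+ f g zero    = sym (+-identityʳ 0#)
  sumBelow-+ f g (suc m) = trans (+-congʳ (sumBelow-+ f g m))
    (solve 4 (λ F G x y → ((F ⊕ G) ⊕ (x ⊕ y)) ⊜ ((F ⊕ x) ⊕ (G ⊕ y))) refl
      (sumBelow f m) (sumBelow g m) (f m) (g m))

  sumBelow-*ˡ : ∀ a (f : ℕ → Carrier) m → sumBelow (λ i → a * f i) m ≈ a * sumBelow f m
  sumBelow-*ˡ a f zero    = sym (zeroʳ a)
  sumBelow-*ˡ a f (suc m) = trans (+-congʳ (sumBelow-*ˡ a f m)) (sym (distribˡ a _ _))

  sumBelow-head : ∀ (f : ℕ → Carrier) m → sumBelow f (suc m) ≈ f 0 + sumBelow (f ∘ suc) m
  sumBelow-head f zero    = +-comm 0# (f 0)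
  sumBelow-head f (suc m) = trans (+-congʳ (sumBelow-head f m)) (+-assoc (f 0) _ _)

  sumBelow-split : ∀ (f : ℕ → Carrier) k m →
                   sumBelow f (k ℕ.+ m) ≈ sumBelow f k + sumBelow (λ j → f (k ℕ.+ j)) m
  sumBelow-split f k zero    rewrite ℕ.+-identityʳ k = sym (+-identityʳ _)
  sumBelow-split f k (suc m) rewrite ℕ.+-suc k m =
    trans (+-congʳ (sumBelow-split f k m)) (+-assoc _ _ _)

  sumFromTo-vanishing : ∀ {f : ℕ → Carrier} k N → (∀ n → n < k → f n ≈ 0#) →
                        sumFromTo k N f ≈ sumBelow f (suc N)
  sumFromTo-vanishing {f} k N f≈0 with ℕ.≤-total k (suc N)
  ... | inj₁ k≤N+1 = begin
    sumBelow (λ j → f (k ℕ.+ j)) (suc N ∸ k)                   ≈⟨ +-identityˡ _ ⟨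
    0# + sumBelow (λ j → f (k ℕ.+ j)) (suc N ∸ k)              ≈⟨ +-congʳ (sumBelow-zero k f≈0) ⟨
    sumBelow f k + sumBelow (λ j → f (k ℕ.+ j)) (suc N ∸ k)    ≈⟨ sumBelow-split f k (suc N ∸ k) ⟨
    sumBelow f (k ℕ.+ (suc N ∸ k))                             ≡⟨ P.cong (sumBelow f) (ℕ.m+[n∸m]≡n k≤N+1) ⟩
    sumBelow f (suc N)                                         ∎
  ... | inj₂ N+1≤k rewrite ℕ.m≤n⇒m∸n≡0 N+1≤k =
    sym (sumBelow-zero (suc N) (λ n n<N+1 → f≈0 n (ℕ.<-≤-trans n<N+1 N+1≤k)))

  ≋-setoid : Setoid c ℓ
  ≋-setoid = record
    { Carrier       = Ser
    ; _≈_           = _≋_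
    ; isEquivalence = record
      { refl  = λ _ → refl
      ; sym   = λ f≋g N → sym (f≋g N)
      ; trans = λ f≋g g≋h N → trans (f≋g N) (g≋h N)
      }
    }

  module ≋ = Setoid ≋-setoid

  VanishesBelow : ℕ → Ser → Set ℓ
  VanishesBelow M f = ∀ j → j < M → f j ≈ 0#

  divXplus : Carrier → Ser → Ser
  divXplus b = mulS (recipLin b)

  -- Multiplication by x + b = t⁻¹ + b, dropping the coefficient of t⁻¹; it is a left
  -- inverse of divXplus b, and an inverse on series without constant term.
  mulXplusS : Carrier → Ser → Ser
  mulXplusS b f N = f (suc N) + b * f N

  powR-cong : ∀ {x y} m → x ≈ y → powR x m ≈ powR y m
  powR-cong zero    x≈y = refl
  powR-cong (suc m) x≈y = *-cong x≈y (powR-cong m x≈y)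

  divXplus-cong : ∀ {a b f g} → a ≈ b → f ≋ g → divXplus a f ≋ divXplus b g
  divXplus-cong {a} {b} {f} {g} a≈b f≋g N =
    sumBelow-cong (suc N) (λ i _ → *-cong (recipLin-cong i) (f≋g (N ∸ i)))
    where
    recipLin-cong : recipLin a ≋ recipLin b
    recipLin-cong zero    = refl
    recipLin-cong (suc m) = powR-cong m (-‿cong a≈b)

  mulXplusS-cong : ∀ {b f g} → f ≋ g → mulXplusS b f ≋ mulXplusS b g
  mulXplusS-cong f≋g N = +-cong (f≋g (suc N)) (*-congˡ (f≋g N))

  divXplus-unfold : ∀ b g N → divXplus b g N ≈ sumBelow (λ i → powR (- b) i * g (N ∸ suc i)) N
  divXplus-unfold b g N = trans (sumBelow-head _ N) (trans (+-congʳ (zeroˡ _)) (+-identityˡ _))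

  divXplus-vanishes : ∀ b {g M} → VanishesBelow M g → VanishesBelow (suc M) (divXplus b g)
  divXplus-vanishes b {g} {M} g≈0 j j≤M = trans (divXplus-unfold b g j) (sumBelow-zero j (λ i i<j →
    trans (*-congˡ (g≈0 (j ∸ suc i) (ℕ.<-≤-trans (ℕ.∸-monoʳ-< ℕ.z<s i<j) (ℕ.≤-pred j≤M)))) (zeroʳ _)))

  mulXplusS-divXplus : ∀ b g → mulXplusS b (divXplus b g) ≋ g
  mulXplusS-divXplus b g N = begin
    divXplus b g (suc N) + b * divXplus b g N
      ≈⟨ +-cong (divXplus-unfold b g (suc N)) (*-congˡ (divXplus-unfold b g N)) ⟩
    sumBelow (λ i → powR (- b) i * g (N ∸ i)) (suc N) + b * S             ≈⟨ +-congʳ (sumBelow-head _ N) ⟩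
    (1# * g N + sumBelow (λ i → (- b * powR (- b) i) * g (N ∸ suc i)) N) + b * S
      ≈⟨ +-congʳ (+-congˡ (trans (sumBelow-cong N (λ i _ → *-assoc _ _ _)) (sumBelow-*ˡ (- b) _ N))) ⟩
    (1# * g N + - b * S) + b * S
      ≈⟨ +-congʳ (+-congʳ (*-identityˡ (g N))) ⟩
    (g N + - b * S) + b * S
      ≈⟨ +-congʳ (+-congˡ (sym (-‿distribˡ-* b S))) ⟩
    (g N - b * S) + b * S
      ≈⟨ //-rightDividesˡ (b * S) (g N) ⟩
    g N                                                                   ∎
    where
    S = sumBelow (λ i → powR (- b) i * g (N ∸ suc i)) N

  mulXplusS-injective : ∀ {b u v} → u 0 ≈ v 0 → mulXplusS b u ≋ mulXplusS b v → u ≋ v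
  mulXplusS-injective u₀≈v₀ bu≋bv zero    = u₀≈v₀
  mulXplusS-injective {b} {u} u₀≈v₀ bu≋bv (suc N) = +-cancelʳ (b * u N) _ _
    (trans (bu≋bv N) (+-congˡ (*-congˡ (sym (mulXplusS-injective u₀≈v₀ bu≋bv N)))))

  divXplus-mulXplusS : ∀ b {f} → f 0 ≈ 0# → divXplus b (mulXplusS b f) ≋ f
  divXplus-mulXplusS b {f} f₀≈0 = mulXplusS-injective {b}
    (trans (divXplus-vanishes b {mulXplusS b f} {0} (λ _ ()) 0 (s≤s z≤n)) (sym f₀≈0))
    (mulXplusS-divXplus b (mulXplusS b f))

  linear-exchange : ∀ a b x y z → (x + b * y) + a * (y + b * z) ≈ (x + a * y) + b * (y + a * z)
  linear-exchange =
    solve 5 (λ A B X Y Z → ((X ⊕ B ⊗ Y) ⊕ A ⊗ (Y ⊕ B ⊗ Z)) ⊜ ((X ⊕ A ⊗ Y) ⊕ B ⊗ (Y ⊕ A ⊗ Z))) refl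

  mulXplusS-comm : ∀ a b f → mulXplusS a (mulXplusS b f) ≋ mulXplusS b (mulXplusS a f)
  mulXplusS-comm a b f N = linear-exchange a b (f (suc (suc N))) (f (suc N)) (f N)

  -- Both sides are the unique series X = O(t²) with (x + a)(x + b) X = g.
  divXplus-comm : ∀ a b g → divXplus a (divXplus b g) ≋ divXplus b (divXplus a g)
  divXplus-comm a b g = ≋.sym
    (≋.trans (divXplus-cong {b} refl (divXplus-cong {a} refl (≋.sym abX≋g)))
    (≋.trans (divXplus-cong {b} refl (divXplus-mulXplusS a {mulXplusS b X} bX₀≈0))
             (divXplus-mulXplusS b (X≈0 0 (s≤s z≤n)))))
    where
    X = divXplus a (divXplus b g)
    X≈0 : VanishesBelow 2 X
    X≈0 = divXplus-vanishes a (divXplus-vanishes b {g} {0} (λ _ ()))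
    bX₀≈0 : mulXplusS b X 0 ≈ 0#
    bX₀≈0 = trans (+-cong (X≈0 1 ℕ.≤-refl) (*-congˡ (X≈0 0 (s≤s z≤n)))) (trans (+-identityˡ _) (zeroʳ b))
    abX≋g : mulXplusS a (mulXplusS b X) ≋ g
    abX≋g = ≋.trans (mulXplusS-comm a b X)
      (≋.trans (mulXplusS-cong (mulXplusS-divXplus a (divXplus b g))) (mulXplusS-divXplus b g))

  recipProd-resp-≋ : ∀ {xs ys} → Pointwise _≈_ xs ys → recipProd xs ≋ recipProd ys
  recipProd-resp-≋ []             = ≋.refl
  recipProd-resp-≋ (x≈y ∷ xs≋ys) = divXplus-cong x≈y (recipProd-resp-≋ xs≋ys)

  recipProd-resp-↭ : ∀ {xs ys} → xs ↭ ys → recipProd xs ≋ recipProd ys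
  recipProd-resp-↭ (↭.refl xs≋ys)     = recipProd-resp-≋ xs≋ys
  recipProd-resp-↭ (↭.prep x≈y p)     = divXplus-cong x≈y (recipProd-resp-↭ p)
  recipProd-resp-↭ {x ∷ y ∷ xs} (↭.swap x≈x′ y≈y′ p) = ≋.trans
    (divXplus-comm x y (recipProd xs))
    (divXplus-cong y≈y′ (divXplus-cong x≈x′ (recipProd-resp-↭ p)))
  recipProd-resp-↭ (↭.trans p q)      = ≋.trans (recipProd-resp-↭ p) (recipProd-resp-↭ q)

  _≐_ : Poly → Poly → Set ℓ
  p ≐ q = ∀ k → coeffP p k ≈ coeffP q k

  coeffP-addP : ∀ p q k → coeffP (addP p q) k ≈ coeffP p k + coeffP q k
  coeffP-addP []      q       k       = sym (+-identityˡ _)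
  coeffP-addP (x ∷ p) []      k       = sym (+-identityʳ _)
  coeffP-addP (x ∷ p) (y ∷ q) zero    = refl
  coeffP-addP (x ∷ p) (y ∷ q) (suc k) = coeffP-addP p q k

  coeffP-map-*ˡ : ∀ b p k → coeffP (map (b *_) p) k ≈ b * coeffP p k
  coeffP-map-*ˡ b []      k       = sym (zeroʳ b)
  coeffP-map-*ˡ b (x ∷ p) zero    = refl
  coeffP-map-*ˡ b (x ∷ p) (suc k) = coeffP-map-*ˡ b p k

  coeffP-mulXplus : ∀ b p k → coeffP (mulXplus b p) k ≈ coeffP (0# ∷ p) k + b * coeffP p k
  coeffP-mulXplus b p k = trans (coeffP-addP (0# ∷ p) (map (b *_) p) k) (+-congˡ (coeffP-map-*ˡ b p k))

  mulXplus-cong : ∀ b {p q} → p ≐ q → mulXplus b p ≐ mulXplus b q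
  mulXplus-cong b {p} {q} p≐q k = begin
    coeffP (mulXplus b p) k               ≈⟨ coeffP-mulXplus b p k ⟩
    coeffP (0# ∷ p) k + b * coeffP p k    ≈⟨ +-cong (shift-cong k) (*-congˡ (p≐q k)) ⟩
    coeffP (0# ∷ q) k + b * coeffP q k    ≈⟨ coeffP-mulXplus b q k ⟨
    coeffP (mulXplus b q) k               ∎
    where
    shift-cong : (0# ∷ p) ≐ (0# ∷ q)
    shift-cong zero    = refl
    shift-cong (suc k) = p≐q k

  shift-mulXplus : ∀ b p → (0# ∷ mulXplus b p) ≐ mulXplus b (0# ∷ p)
  shift-mulXplus b p zero    = sym (trans (+-identityˡ _) (zeroʳ b))
  shift-mulXplus b p (suc k) = refl

  mulXplus-comm : ∀ a b p → mulXplus a (mulXplus b p) ≐ mulXplus b (mulXplus a p)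
  mulXplus-comm a b p k = begin
    coeffP (mulXplus a (mulXplus b p)) k                ≈⟨ expand a b ⟩
    (c₂ + b * c₁) + a * (c₁ + b * c₀)                   ≈⟨ linear-exchange a b c₂ c₁ c₀ ⟩
    (c₂ + a * c₁) + b * (c₁ + a * c₀)                   ≈⟨ expand b a ⟨
    coeffP (mulXplus b (mulXplus a p)) k                ∎
    where
    c₀ = coeffP p k
    c₁ = coeffP (0# ∷ p) k
    c₂ = coeffP (0# ∷ 0# ∷ p) k
    expand : ∀ u v → coeffP (mulXplus u (mulXplus v p)) k ≈ (c₂ + v * c₁) + u * (c₁ + v * c₀)
    expand u v = trans (coeffP-mulXplus u (mulXplus v p) k)
      (+-cong (trans (shift-mulXplus v p k) (coeffP-mulXplus v (0# ∷ p) k))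
              (*-congˡ (coeffP-mulXplus v p k)))

  linProd : (ℕ → Carrier) → ℕ → Poly
  linProd a zero    = 1# ∷ []
  linProd a (suc n) = mulXplus (a n) (linProd a n)

  linCoeff : (ℕ → Carrier) → ℕ → ℕ → Carrier
  linCoeff a n k = coeffP (linProd a n) k

  linProd-suc : ∀ a n → linProd a (suc n) ≐ mulXplus (a 0) (linProd (a ∘ suc) n)
  linProd-suc a zero    k = refl
  linProd-suc a (suc n) k = begin
    coeffP (mulXplus (a (suc n)) (linProd a (suc n))) k
      ≈⟨ mulXplus-cong (a (suc n)) {linProd a (suc n)} {mulXplus (a 0) (linProd (a ∘ suc) n)}
                       (linProd-suc a n) k ⟩
    coeffP (mulXplus (a (suc n)) (mulXplus (a 0) (linProd (a ∘ suc) n))) k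
      ≈⟨ mulXplus-comm (a (suc n)) (a 0) (linProd (a ∘ suc) n) k ⟩
    coeffP (mulXplus (a 0) (linProd (a ∘ suc) (suc n))) k ∎

  linCoeff-suc : ∀ a n k →
    linCoeff a (suc n) k ≈ coeffP (0# ∷ linProd (a ∘ suc) n) k + a 0 * linCoeff (a ∘ suc) n k
  linCoeff-suc a n k = trans (linProd-suc a n k) (coeffP-mulXplus (a 0) _ k)

  linCoeff-degree : ∀ a {n k} → n < k → linCoeff a n k ≈ 0#
  linCoeff-degree a {zero}  {suc k} _         = refl
  linCoeff-degree a {suc n} {suc k} (s≤s n<k) = begin
    linCoeff a (suc n) (suc k)                          ≈⟨ coeffP-mulXplus (a n) (linProd a n) (suc k) ⟩
    linCoeff a n k + a n * linCoeff a n (suc k)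
      ≈⟨ +-cong (linCoeff-degree a n<k) (*-congˡ (linCoeff-degree a (ℕ.m<n⇒m<1+n n<k))) ⟩
    0# + a n * 0#                                       ≈⟨ trans (+-identityˡ _) (zeroʳ _) ⟩
    0#                                                  ∎

  recipLinProd : (ℕ → Carrier) → ℕ → Ser
  recipLinProd a n = recipProd (applyUpTo a (suc n))

  recipLinProd-vanishes : ∀ a n → VanishesBelow (suc n) (recipLinProd a n)
  recipLinProd-vanishes a zero    = divXplus-vanishes (a 0) {oneS} (λ _ ())
  recipLinProd-vanishes a (suc n) = divXplus-vanishes (a 0) (recipLinProd-vanishes (a ∘ suc) n)

  partialSum : (ℕ → Carrier) → ℕ → ℕ → Ser
  partialSum a k M N = sumBelow (λ n → linCoeff a n k * recipLinProd a n N) M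

  partialSum-extend : ∀ a k {M N} → N ≤ M → partialSum a k (suc M) N ≈ partialSum a k M N
  partialSum-extend a k {M} N≤M =
    trans (+-congˡ (trans (*-congˡ (recipLinProd-vanishes a M _ (s≤s N≤M))) (zeroʳ _))) (+-identityʳ _)

  mulXplusS-sumBelow : ∀ b (c : ℕ → Carrier) (f : ℕ → Ser) M N →
    mulXplusS b (λ N → sumBelow (λ n → c n * f n N) M) N ≈ sumBelow (λ n → c n * mulXplusS b (f n) N) M
  mulXplusS-sumBelow b c f M N = begin
    sumBelow (λ n → c n * f n (suc N)) M + b * sumBelow (λ n → c n * f n N) M
      ≈⟨ +-congˡ (sumBelow-*ˡ b _ M) ⟨
    sumBelow (λ n → c n * f n (suc N)) M + sumBelow (λ n → b * (c n * f n N)) M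
      ≈⟨ sumBelow-+ _ _ M ⟨
    sumBelow (λ n → c n * f n (suc N) + b * (c n * f n N)) M
      ≈⟨ sumBelow-cong M (λ n _ → solve 4 (λ B C F₁ F₀ → (C ⊗ F₁ ⊕ B ⊗ (C ⊗ F₀)) ⊜ (C ⊗ (F₁ ⊕ B ⊗ F₀)))
                                          refl b (c n) (f n (suc N)) (f n N)) ⟩
    sumBelow (λ n → c n * mulXplusS b (f n) N) M ∎

  mulXplusS-partialSum : ∀ a k N →
    mulXplusS (a 0) (partialSum a k (suc (suc N))) N
      ≈ linCoeff a 0 k * oneS N + sumBelow (λ m → linCoeff a (suc m) k * recipLinProd (a ∘ suc) m N) (suc N)
  mulXplusS-partialSum a k N = begin
    mulXplusS (a 0) (partialSum a k (suc (suc N))) N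
      ≈⟨ mulXplusS-sumBelow (a 0) (λ n → linCoeff a n k) (recipLinProd a) (suc (suc N)) N ⟩
    sumBelow (λ n → linCoeff a n k * mulXplusS (a 0) (recipLinProd a n) N) (suc (suc N))
      ≈⟨ sumBelow-head _ (suc N) ⟩
    linCoeff a 0 k * mulXplusS (a 0) (divXplus (a 0) oneS) N
      + sumBelow (λ m → linCoeff a (suc m) k * mulXplusS (a 0) (divXplus (a 0) (recipLinProd (a ∘ suc) m)) N) (suc N)
      ≈⟨ +-cong (*-congˡ (mulXplusS-divXplus (a 0) oneS N))
                (sumBelow-cong (suc N) (λ m _ → *-congˡ (mulXplusS-divXplus (a 0) (recipLinProd (a ∘ suc) m) N))) ⟩
    linCoeff a 0 k * oneS N + sumBelow (λ m → linCoeff a (suc m) k * recipLinProd (a ∘ suc) m N) (suc N) ∎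

  sumBelow-linCoeff-suc : ∀ a k (f : ℕ → Carrier) M →
    sumBelow (λ m → linCoeff a (suc m) k * f m) M
      ≈ sumBelow (λ m → coeffP (0# ∷ linProd (a ∘ suc) m) k * f m) M
        + a 0 * sumBelow (λ m → linCoeff (a ∘ suc) m k * f m) M
  sumBelow-linCoeff-suc a k f M = begin
    sumBelow (λ m → linCoeff a (suc m) k * f m) M
      ≈⟨ sumBelow-cong M (λ m _ → trans (*-congʳ (linCoeff-suc a m k)) (distribʳ (f m) _ _)) ⟩
    sumBelow (λ m → coeffP (0# ∷ linProd (a ∘ suc) m) k * f m + (a 0 * linCoeff (a ∘ suc) m k) * f m) M
      ≈⟨ sumBelow-+ _ _ M ⟩
    sumBelow (λ m → coeffP (0# ∷ linProd (a ∘ suc) m) k * f m) M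
      + sumBelow (λ m → (a 0 * linCoeff (a ∘ suc) m k) * f m) M
      ≈⟨ +-congˡ (trans (sumBelow-cong M (λ m _ → *-assoc _ _ _)) (sumBelow-*ˡ (a 0) _ M)) ⟩
    sumBelow (λ m → coeffP (0# ∷ linProd (a ∘ suc) m) k * f m) M
      + a 0 * sumBelow (λ m → linCoeff (a ∘ suc) m k * f m) M ∎

  partialSum-tpow : ∀ N a k → partialSum a k (suc N) N ≈ tpow (suc k) N
  partialSum-tpow zero a k =
    trans (+-identityˡ _) (trans (*-congˡ (recipLinProd-vanishes a 0 0 (s≤s z≤n))) (zeroʳ _))
  partialSum-tpow (suc N) a k = +-cancelʳ (a 0 * tpow (suc k) N) _ _ (begin
    partialSum a k (suc (suc N)) (suc N) + a 0 * tpow (suc k) N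
      ≈⟨ +-congˡ (*-congˡ (trans (partialSum-extend a k (ℕ.n≤1+n N)) (partialSum-tpow N a k))) ⟨
    mulXplusS (a 0) (partialSum a k (suc (suc N))) N
      ≈⟨ mulXplusS-partialSum a k N ⟩
    linCoeff a 0 k * oneS N + sumBelow (λ m → linCoeff a (suc m) k * Q′ m N) (suc N)
      ≈⟨ +-congˡ (sumBelow-linCoeff-suc a k (λ m → Q′ m N) (suc N)) ⟩
    linCoeff a 0 k * oneS N + (sumBelow (λ m → coeffP (0# ∷ linProd a′ m) k * Q′ m N) (suc N)
                               + a 0 * partialSum a′ k (suc N) N)
      ≈⟨ +-assoc _ _ _ ⟨
    (linCoeff a 0 k * oneS N + sumBelow (λ m → coeffP (0# ∷ linProd a′ m) k * Q′ m N) (suc N))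
      + a 0 * partialSum a′ k (suc N) N
      ≈⟨ +-cong (shifted k) (*-congˡ (partialSum-tpow N a′ k)) ⟩
    tpow (suc k) (suc N) + a 0 * tpow (suc k) N ∎)
    where
    a′ = a ∘ suc
    Q′ = recipLinProd a′
    shifted : ∀ k → linCoeff a 0 k * oneS N + sumBelow (λ m → coeffP (0# ∷ linProd a′ m) k * Q′ m N) (suc N)
                    ≈ tpow (suc k) (suc N)
    shifted zero = begin
      1# * oneS N + sumBelow (λ m → 0# * Q′ m N) (suc N)
        ≈⟨ +-cong (*-identityˡ _) (sumBelow-zero (suc N) (λ m _ → zeroˡ _)) ⟩
      oneS N + 0#                                        ≈⟨ +-identityʳ _ ⟩
      oneS N                                             ≈⟨ oneS≈tpow N ⟩
      tpow 1 (suc N)                                     ∎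
      where
      oneS≈tpow : ∀ N → oneS N ≈ tpow 1 (suc N)
      oneS≈tpow zero    = refl
      oneS≈tpow (suc N) = refl
    shifted (suc k) = trans (+-cong (zeroˡ _) (partialSum-tpow N a′ k)) (+-identityˡ _)

  tpow-inverseFactorialSeries : ∀ a k →
    tpow (suc k) ≋ sumFromS k (λ n → scaleS (linCoeff a n k) (recipLinProd a n))
  tpow-inverseFactorialSeries a k N = sym (trans
    (sumFromTo-vanishing k N (λ n n<k → trans (*-congʳ (linCoeff-degree a n<k)) (zeroˡ _)))
    (partialSum-tpow N a k))

  sumFromS-cong : ∀ k {F G : ℕ → Ser} → (∀ n → F n ≋ G n) → sumFromS k F ≋ sumFromS k G
  sumFromS-cong k F≋G N = sumBelow-cong (suc N ∸ k) (λ j _ → F≋G (k ℕ.+ j) N)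

  scaleS-cong : ∀ a {f g} → f ≋ g → scaleS a f ≋ scaleS a g
  scaleS-cong a f≋g N = *-congˡ (f≋g N)

module RisingFactorial {c ℓ : Level} (R : CommutativeRing c ℓ) (lam : CommutativeRing.Carrier R) (r : ℕ) where
  open CommutativeRing R hiding (zero)
  open Series R
  open InverseFactorialSeries R
  open import Algebra.Properties.Group +-group using (//-rightDividesʳ)
  open import Tactic.RingSolver.NonReflective (fromCommutativeRing R (λ _ → nothing))
    using (solve; _⊕_; _⊗_; _⊜_)
  import Data.List.Relation.Binary.Permutation.Setoid setoid as ↭
  open ↭ using (_↭_)
  open import Data.List.Relation.Binary.Permutation.Setoid.Properties setoid using (↭-reverse; ++⁺ʳ)

  node : ℕ → Carrier
  node j = natR r + natR j * lam

  linProd-node : ∀ n → linProd node n P.≡ risingPoly lam r n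
  linProd-node zero    = P.refl
  linProd-node (suc n) = P.cong (mulXplus (node n)) (linProd-node n)

  factors₁-applyUpTo : ∀ n → factors₁ lam r n P.≡ applyUpTo node (suc n)
  factors₁-applyUpTo n = map-upTo node (suc n)

  natR-+ : ∀ m n → natR (m ℕ.+ n) ≈ natR m + natR n
  natR-+ zero    n = sym (+-identityˡ _)
  natR-+ (suc m) n = trans (+-congˡ (natR-+ m n)) (sym (+-assoc _ _ _))

  falling : ℕ → ℕ → Carrier
  falling n i = (natR r + (natR n * lam - lam)) - natR i * lam

  falling≈node : ∀ n i → i < n → falling n i ≈ node (n ∸ suc i)
  falling≈node n i i<n = begin
    (natR r + (natR n * lam - lam)) - natR i * lam
      ≈⟨ +-congʳ (+-congˡ (+-congʳ nλ≈)) ⟩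
    (natR r + (((natR d * lam + natR i * lam) + lam) - lam)) - natR i * lam
      ≈⟨ +-congʳ (+-congˡ (//-rightDividesʳ lam _)) ⟩
    (natR r + (natR d * lam + natR i * lam)) - natR i * lam
      ≈⟨ +-congʳ (+-assoc _ _ _) ⟨
    ((natR r + natR d * lam) + natR i * lam) - natR i * lam
      ≈⟨ //-rightDividesʳ (natR i * lam) _ ⟩
    natR r + natR d * lam ∎
    where
    open SetoidReasoning setoid
    d = n ∸ suc i
    nλ≈ : natR n * lam ≈ (natR d * lam + natR i * lam) + lam
    nλ≈ = begin
      natR n * lam                           ≡⟨ P.cong (λ m → natR m * lam) (ℕ.m+[n∸m]≡n i<n) ⟨
      (1# + natR (i ℕ.+ d)) * lam             ≈⟨ distribʳ lam 1# _ ⟩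
      1# * lam + natR (i ℕ.+ d) * lam
        ≈⟨ +-cong (*-identityˡ lam) (trans (*-congʳ (natR-+ i d)) (distribʳ lam _ _)) ⟩
      lam + (natR i * lam + natR d * lam)
        ≈⟨ solve 3 (λ Λ X Y → (Λ ⊕ (X ⊕ Y)) ⊜ ((Y ⊕ X) ⊕ Λ)) refl lam _ _ ⟩
      (natR d * lam + natR i * lam) + lam     ∎

  applyUpTo≋applyDownFrom : ∀ n {f g : ℕ → Carrier} → (∀ i → i < n → f i ≈ g (n ∸ suc i)) →
                            Pointwise _≈_ (applyUpTo f n) (applyDownFrom g n)
  applyUpTo≋applyDownFrom zero    f≈g = []
  applyUpTo≋applyDownFrom (suc n) f≈g =
    f≈g 0 (s≤s z≤n) ∷ applyUpTo≋applyDownFrom n (λ i i<n → f≈g (suc i) (s≤s i<n))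

  factors₂-applyUpTo : ∀ n → factors₂ lam r n P.≡ applyUpTo (falling n) n ++ node n ∷ []
  factors₂-applyUpTo n = P.trans (P.sym (++-is-foldr (map (falling n) (upTo n)) (node n ∷ [])))
                                 (P.cong (_++ node n ∷ []) (map-upTo (falling n) n))

  -- factors₂ lists the first n nodes in decreasing order, then node n.
  factors₂↭factors₁ : ∀ n → factors₂ lam r n ↭ factors₁ lam r n
  factors₂↭factors₁ n = begin
    factors₂ lam r n                              ≡⟨ factors₂-applyUpTo n ⟩
    applyUpTo (falling n) n ++ node n ∷ []
      ≋⟨ Pointwise.++⁺ (applyUpTo≋applyDownFrom n (falling≈node n)) (refl ∷ []) ⟩
    applyDownFrom node n ++ node n ∷ []           ≡⟨ P.cong (_++ node n ∷ []) (P.sym (reverse-applyUpTo node n)) ⟩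
    reverse (applyUpTo node n) ++ node n ∷ []     ↭⟨ ++⁺ʳ _ (↭-reverse (applyUpTo node n)) ⟩
    applyUpTo node n ++ node n ∷ []               ≡⟨ applyUpTo-∷ʳ node n ⟩
    applyUpTo node (suc n)                        ≡⟨ P.sym (factors₁-applyUpTo n) ⟩
    factors₁ lam r n                              ∎
    where open ↭.PermutationReasoning

  stirling-factors₁ : ∀ k →
    tpow (suc k) ≋ sumFromS k (λ n → scaleS (stirR lam r n k) (recipProd (factors₁ lam r n)))
  stirling-factors₁ k = ≋.trans (tpow-inverseFactorialSeries node k) (sumFromS-cong k (λ n →
    ≋.reflexive (P.cong₂ (λ p l → scaleS (coeffP p k) (recipProd l))
                         (linProd-node n) (P.sym (factors₁-applyUpTo n)))))

  stirling-factors₁≋factors₂ : ∀ k →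
    sumFromS k (λ n → scaleS (stirR lam r n k) (recipProd (factors₁ lam r n)))
      ≋ sumFromS k (λ n → scaleS (stirR lam r n k) (recipProd (factors₂ lam r n)))
  stirling-factors₁≋factors₂ k = sumFromS-cong k (λ n →
    scaleS-cong (stirR lam r n k) (≋.sym (recipProd-resp-↭ (factors₂↭factors₁ n))))

corollary9 : ∀ {c ℓ : Level} (R : CommutativeRing c ℓ) (lam : CommutativeRing.Carrier R) (r k : ℕ) →
    let open Series R in
      (tpow (suc k) ≋ sumFromS k (λ n → scaleS (stirR lam r n k) (recipProd (factors₁ lam r n))))
      × (tpow (suc k) ≋ sumFromS k (λ n → scaleS (stirR lam r n k) (recipProd (factors₂ lam r n))))
corollary9 R lam r k =
  stirling-factors₁ k , ≋.trans (stirling-factors₁ k) (stirling-factors₁≋factors₂ k)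
  where
  open InverseFactorialSeries R
  open RisingFactorial R lam r
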